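{- Let $n\ge2$, $\lambda$ a strict partition, and $T\in\mathrm{PT}_n(\lambda)$. The odd Kashiwara operator $\tilde f_{\bar1}^P$ acts as follows. If the first row of $T$ contains no letter $1$, then $\tilde f_{\bar1}^PT=\mathbf0$. Otherwise let $(1,i)$ be the position of the rightmost $1$ in the first row. (1) If $i=1$: if $T_{1,2}=2'$ then $\tilde f_{\bar1}^PT=\mathbf0$; otherwise $\tilde f_{\bar1}^PT$ is obtained by changing $T_{1,1}=1$ to $2$. (2) If $i\ge2$: if $T_{1,i+1}=2'$ then $\tilde f_{\bar1}^PT=\mathbf 0$; otherwise $\tilde f_{\bar1}^PT$ is obtained by changing $T_{1,i}=1$ to $2'$.
   Context: Shifted diagram of a strict partition $\lambda=(\lambda_1>\dots>\lambda_l>0)$: $S(\lambda)=\{(i,j):1\le i\le l,\ i\le j\le\lambda_i+i-1\}$; $T_{i,j}$ is the entry at row $i$ (row 1 on top), column $j$; the main diagonal is $\{(i,i)\}$. A primed tableau of shape $\lambda$ is a filling of $S(\lambda)$ with letters $1'<1<2'<2<\dots<n'<n$ such that entries weakly increase along rows and columns, each row contains at most one $i'$ for each $i$, each column contains at most one $i$ for each $i$, and there are no primed letters on the main diagonal; $\mathrm{PT}_n(\lambda)$ is the set of these. A standard shifted Young tableau of shape $\lambda$ is a filling of $S(\lambda)$ with $1,\dots,|\lambda|$, each once, increasing along rows and columns. Words: for a word $\boldsymbol b=b_1\cdots b_m$ over $\{1,\dots,n\}$: if there is no letter $1$, $\tilde f_{\bar1}\boldsymbol b=\mathbf 0$; otherwise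 let $b_k$ be the leftmost $1$; if a letter $2$ occurs among $b_1,\dots,b_{k-1}$ then $\tilde f_{\bar1}\boldsymbol b=\mathbf 0$, otherwise $\tilde f_{\bar 1}\boldsymbol b$ is $\boldsymbol b$ with $b_k$ changed to $2$. Semistandard shifted mixed insertion: for $\boldsymbol b=b_1\cdots b_m$, build $(T^{(0)},Q^{(0)})=(\emptyset,\emptyset)$ and $(T^{(i)},Q^{(i)})$ from $(T^{(i-1)},Q^{(i-1)})$: insert $x=b_i$ into the first row, bumping the leftmost entry strictly greater than $x$ (replacing it by $x$), or appending $x$ at the end of the row and stopping if there is none. If $a$ is bumped: if $a$ was off the main diagonal and unprimed, insert $a$ into the next row (bump leftmost entry strictly greater than $a$, or append at the end of the row); if $a$ was off the diagonal and primed, insert $a$ into the next column to the right (bump topmost entry strictly greater than $a$, or append at the bottom of the column); if $a$ was on the main diagonal, replace it by $a'$ and insert into the column to the right likewise. Repeat until an entry is appended. $Q^{(i)}$ is $Q^{(i-1)}$ plus entry $i$ in the new box. $\mathrm{HM}(\boldsymbol b)=(T^{(m)},Q^{(m)})$, $P_{HM}(\boldsymbol b)=T^{(m)}$; $\mathrm{HM}$ is a bijection from words of length $m$ onto pairs $(T,Q)$ with $T$ a primed tableau and $Q$ a standard shifted Young tableau of the same strict shape of size $m$. Definition of the operator: for $|\lambda|=m$, fix a standard shifted Young tableau $Q_\lambda$ of shape $\lambda$ and set $\tilde f_{\bar1}^PT=P_{HM}(\tilde f_{\bar1}(\mathrm{HM}^{ -1}(T,Q_\lambda)))$ (equal to $\mathbf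 0$ if $\tilde f_{\bar1}$ of the word is $\mathbf 0$). -}

module Defs where

open import Data.Nat using (ℕ; zero; suc; _+_; _*_; _∸_; _<_; _≤_; _>_; _<ᵇ_; _≤ᵇ_; _≡ᵇ_)
open import Data.Bool using (Bool; true; false; if_then_else_)
open import Data.List using (List; []; _∷_; _++_; [_]; length; map; concat; upTo)
open import Data.Nat.ListAction using (sum)
open import Data.List.Relation.Unary.All using (All)
open import Data.List.Relation.Unary.Linked using (Linked)
open import Data.List.Relation.Binary.Permutation.Propositional using (_↭_)
open import Data.Maybe using (Maybe; just; nothing)
import Data.Maybe as Maybe
open import Data.Product using (_×_; _,_; proj₁; proj₂)
open import Relation.Binary.PropositionalEquality using (_≡_; _≢_)

-- Letters 1' < 1 < 2' < 2 < ...   (unp i = i, pri i = i')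

data Letter : Set where
  unp : ℕ → Letter
  pri : ℕ → Letter

code : Letter → ℕ
code (pri i) = 2 * i
code (unp i) = suc (2 * i)

_≤L_ : Letter → Letter → Set
a ≤L b = code a ≤ code b

_<L_ : Letter → Letter → Set
a <L b = code a < code b

prime : Letter → Letter
prime (unp i) = pri i
prime (pri i) = pri i

-- Shifted tableaux: list of rows; row r (0-indexed) starts in column r.
-- So list index k of row r is the box (r , r + k) (0-indexed coordinates);
-- the paper's T_{i,j} is  box T (i - 1) (j - 1).

Tab : Set → Set
Tab A = List (List A)

at : {A : Set} → List A → ℕ → Maybe A
at []       _       = nothing
at (x ∷ xs) zero    = just x
at (x ∷ xs) (suc k) = at xs k

getRow : {A : Set} → Tab A → ℕ → List A
getRow []       _       = []
getRow (r ∷ rs) zero    = r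
getRow (r ∷ rs) (suc i) = getRow rs i

setRow : {A : Set} → Tab A → ℕ → List A → Tab A
setRow []       zero    new = new ∷ []
setRow []       (suc i) new = [] ∷ setRow [] i new
setRow (r ∷ rs) zero    new = new ∷ rs
setRow (r ∷ rs) (suc i) new = r ∷ setRow rs i new

updateAt : {A : Set} → List A → ℕ → A → List A
updateAt []       _       a = []
updateAt (x ∷ xs) zero    a = a ∷ xs
updateAt (x ∷ xs) (suc k) a = x ∷ updateAt xs k a

setEntry : {A : Set} → Tab A → ℕ → ℕ → A → Tab A
setEntry T r k a = setRow T r (updateAt (getRow T r) k a)

box : {A : Set} → Tab A → ℕ → ℕ → Maybe A
box T r c = if r ≤ᵇ c then at (getRow T r) (c ∸ r) else nothing

size : {A : Set} → Tab A → ℕ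
size T = sum (map length T)

StrictPartition : List ℕ → Set
StrictPartition sh = Linked _>_ sh × All (λ k → 0 < k) sh

shape : {A : Set} → Tab A → List ℕ
shape T = map length T

InAlphabet : ℕ → Letter → Set
InAlphabet n (unp i) = 1 ≤ i × i ≤ n
InAlphabet n (pri i) = 1 ≤ i × i ≤ n

record PrimedTableau (n : ℕ) (sh : List ℕ) (T : Tab Letter) : Set where
  field
    hasShape   : shape T ≡ sh
    letters    : ∀ r c a → box T r c ≡ just a → InAlphabet n a
    rowWeak    : ∀ r c a b → box T r c ≡ just a → box T r (suc c) ≡ just b → a ≤L b
    colWeak    : ∀ r c a b → box T r c ≡ just a → box T (suc r) c ≡ just b → a ≤L b
    rowPrimes  : ∀ r c c' i → box T r c ≡ just (pri i) → box T r c' ≡ just (pri i) → c ≡ c'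
    colUnprim  : ∀ r r' c i → box T r c ≡ just (unp i) → box T r' c ≡ just (unp i) → r ≡ r'
    diagUnprim : ∀ r i → box T r r ≢ just (pri i)

record StandardShifted (sh : List ℕ) (Q : Tab ℕ) : Set where
  field
    hasShape  : shape Q ≡ sh
    entries   : concat Q ↭ map suc (upTo (sum sh))
    rowStrict : ∀ r c a b → box Q r c ≡ just a → box Q r (suc c) ≡ just b → a < b
    colStrict : ∀ r c a b → box Q r c ≡ just a → box Q (suc r) c ≡ just b → a < b

Word : ℕ → List ℕ → Set
Word n b = All (λ x → 1 ≤ x × x ≤ n) b

-- The operator f̄₁ on words (nothing = 𝟎)

fbar1 : List ℕ → Maybe (List ℕ)
fbar1 []                    = nothing
fbar1 (suc zero ∷ bs)       = just (2 ∷ bs)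
fbar1 (suc (suc zero) ∷ bs) = nothing
fbar1 (b ∷ bs)              = Maybe.map (b ∷_) (fbar1 bs)

rowBump : Letter → List Letter → Maybe (ℕ × Letter)
rowBump x [] = nothing
rowBump x (y ∷ ys) =
  if code x <ᵇ code y then just (0 , y)
  else Maybe.map (λ p → suc (proj₁ p) , proj₂ p) (rowBump x ys)

data ColRes : Set where
  bumpAt   : ℕ → Letter → ColRes
  appendAt : ℕ → ColRes

colFind : Letter → ℕ → ℕ → Tab Letter → ColRes
colFind x c r [] = appendAt r
colFind x c r (row ∷ rows) with r ≤ᵇ c | at row (c ∸ r)
... | true  | just y = if code x <ᵇ code y then bumpAt r y else colFind x c (suc r) rows
... | _     | _      = appendAt r

data Mode : Set where
  rowM : ℕ → Mode
  colM : ℕ → Mode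

afterBump : ℕ → ℕ → Letter → Mode × Letter
afterBump r c a with r ≡ᵇ c
afterBump r c a       | true  = colM (suc c) , prime a
afterBump r c (unp i) | false = rowM (suc r) , unp i
afterBump r c (pri i) | false = colM (suc c) , pri i

-- one insertion, with fuel (the fuel supplied below always suffices);
-- returns the new tableau and the new box (r , c)
ins : ℕ → Mode → Letter → Tab Letter → Tab Letter × (ℕ × ℕ)
ins zero    _        x T = T , (0 , 0)
ins (suc f) (rowM r) x T with rowBump x (getRow T r)
... | nothing      = setRow T r (getRow T r ++ [ x ]) , (r , r + length (getRow T r))
... | just (k , a) = ins f (proj₁ m) (proj₂ m) (setEntry T r k x)
  where m = afterBump r (r + k) a
ins (suc f) (colM c) x T with colFind x c 0 T
... | appendAt r = setRow T r (getRow T r ++ [ x ]) , (r , c)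
... | bumpAt r a = ins f (proj₁ m) (proj₂ m) (setEntry T r (c ∸ r) x)
  where m = afterBump r c a

fuel : Tab Letter → ℕ
fuel T = (size T + 2) * (size T + 2)

hmStep : Tab Letter × Tab ℕ → ℕ → ℕ → Tab Letter × Tab ℕ
hmStep (T , Q) i b with ins (fuel T) (rowM 0) (unp b) T
... | T' , (r , c) = T' , setRow Q r (getRow Q r ++ [ i ])

hmFrom : ℕ → Tab Letter × Tab ℕ → List ℕ → Tab Letter × Tab ℕ
hmFrom i acc []       = acc
hmFrom i acc (b ∷ bs) = hmFrom (suc i) (hmStep acc i b) bs

HM : List ℕ → Tab Letter × Tab ℕ
HM b = hmFrom 1 ([] , []) b

PHM : List ℕ → Tab Letter
PHM b = proj₁ (HM b)

-- the word-level result transported by HM:  P_HM(f̄₁ b)  (nothing = 𝟎)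
fbar1P-word : List ℕ → Maybe (Tab Letter)
fbar1P-word b = Maybe.map PHM (fbar1 b)

RightmostOne : List Letter → ℕ → Set
RightmostOne row k = at row k ≡ just (unp 1) × (∀ j → k < j → at row j ≢ just (unp 1))

module Submission where

-- Cut the word b at its first letter c ≤ 2: b = u c v with all of u ≥ 3.
--  * Letters ≥ 2 never bump a 1, 2' or 2 out of the first row, so a first row
--    "P R" (P small, R large) keeps this shape under their insertion
--    (insert-keeps-prefix), and raising a 1 of the first row to a letter ≤ 2
--    commutes with inserting them (insert-setEntry-comm).
--  * c = 2 (f̄₁ b = 0): the first row of P(u 2 w) is "2 R" (no 1) or "1…1 2' R"
--    (the rightmost 1 is followed by 2'), invariantly in w (twoFirst-word).
--  * c = 1 (f̄₁ b = u 2 v): the first row of P(u 1 w) is "1…1 R", and P(u 2 w)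
--    is P(u 1 w) with its rightmost 1 raised to 2 on the diagonal, to 2' off
--    it (raised-word).  With no such c, b has no 1, f̄₁ b = 0, and neither has
--    the first row.

open import Defs
open import Data.Nat using (ℕ; zero; suc; _≤_; _<_; _+_; _*_; _∸_; _<ᵇ_; _≤ᵇ_; _≡ᵇ_; z≤n; s≤s)
open import Data.Nat.Properties
open import Data.Bool using (true; false; if_then_else_)
import Data.Bool as Bool
open import Data.List using (List; []; _∷_; _++_; [_]; length; replicate)
open import Data.List.Properties using (++-assoc; ++-identityʳ)
open import Data.List.Relation.Unary.All using (All; []; _∷_)
import Data.List.Relation.Unary.All as All
open import Data.List.Relation.Unary.All.Properties using (++⁺)
open import Data.Maybe using (Maybe; just; nothing)
import Data.Maybe as Maybe
open import Data.Product using (_×_; _,_; proj₁; proj₂; ∃-syntax)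
open import Data.Sum using (_⊎_; inj₁; inj₂)
open import Data.Empty using (⊥-elim)
open import Data.Unit using (tt)
open import Function using (_∘_)
open import Relation.Nullary using (yes; no)
open import Relation.Binary using (tri<; tri≈; tri>)
open import Relation.Binary.PropositionalEquality hiding ([_])

<ᵇ-true⇒< : ∀ {m n} → (m <ᵇ n) ≡ true → m < n
<ᵇ-true⇒< {m} {n} eq = <ᵇ⇒< m n (subst Bool.T (sym eq) tt)

<ᵇ-false⇒≥ : ∀ {m n} → (m <ᵇ n) ≡ false → n ≤ m
<ᵇ-false⇒≥ eq = ≮⇒≥ (λ m<n → subst Bool.T eq (<⇒<ᵇ m<n))

<⇒<ᵇ-true : ∀ {m n} → m < n → (m <ᵇ n) ≡ true
<⇒<ᵇ-true {m} {n} m<n with m <ᵇ n in eq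
... | true  = refl
... | false = ⊥-elim (<⇒≱ m<n (<ᵇ-false⇒≥ eq))

≥⇒<ᵇ-false : ∀ {m n} → n ≤ m → (m <ᵇ n) ≡ false
≥⇒<ᵇ-false {m} {n} n≤m with m <ᵇ n in eq
... | false = refl
... | true  = ⊥-elim (<⇒≱ (<ᵇ-true⇒< eq) n≤m)

at-updateAt-same : ∀ {A : Set} (xs : List A) k {y} a → at xs k ≡ just y → at (updateAt xs k a) k ≡ just a
at-updateAt-same (x ∷ xs) zero    a _ = refl
at-updateAt-same (x ∷ xs) (suc k) a p = at-updateAt-same xs k a p

at-updateAt-other : ∀ {A : Set} (xs : List A) k j a → k ≢ j → at (updateAt xs k a) j ≡ at xs j
at-updateAt-other []       k       j       a _  = refl
at-updateAt-other (x ∷ xs) zero    zero    a ne = ⊥-elim (ne refl)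
at-updateAt-other (x ∷ xs) zero    (suc j) a ne = refl
at-updateAt-other (x ∷ xs) (suc k) zero    a ne = refl
at-updateAt-other (x ∷ xs) (suc k) (suc j) a ne = at-updateAt-other xs k j a (ne ∘ cong suc)

updateAt-idem : ∀ {A : Set} (xs : List A) k a b → updateAt (updateAt xs k a) k b ≡ updateAt xs k b
updateAt-idem []       k       a b = refl
updateAt-idem (x ∷ xs) zero    a b = refl
updateAt-idem (x ∷ xs) (suc k) a b = cong (x ∷_) (updateAt-idem xs k a b)

updateAt-comm : ∀ {A : Set} (xs : List A) k j a b → k ≢ j →
  updateAt (updateAt xs k a) j b ≡ updateAt (updateAt xs j b) k a
updateAt-comm []       k       j       a b _  = refl
updateAt-comm (x ∷ xs) zero    zero    a b ne = ⊥-elim (ne refl)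
updateAt-comm (x ∷ xs) zero    (suc j) a b ne = refl
updateAt-comm (x ∷ xs) (suc k) zero    a b ne = refl
updateAt-comm (x ∷ xs) (suc k) (suc j) a b ne = cong (x ∷_) (updateAt-comm xs k j a b (ne ∘ cong suc))

updateAt-self : ∀ {A : Set} (xs : List A) k {a} → at xs k ≡ just a → updateAt xs k a ≡ xs
updateAt-self (x ∷ xs) zero    refl = refl
updateAt-self (x ∷ xs) (suc k) p    = cong (x ∷_) (updateAt-self xs k p)

updateAt-++ : ∀ {A : Set} (xs ys : List A) k {y} a → at xs k ≡ just y → updateAt xs k a ++ ys ≡ updateAt (xs ++ ys) k a
updateAt-++ (x ∷ xs) ys zero    a p = refl
updateAt-++ (x ∷ xs) ys (suc k) a p = cong (x ∷_) (updateAt-++ xs ys k a p)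

length-updateAt : ∀ {A : Set} (xs : List A) k a → length (updateAt xs k a) ≡ length xs
length-updateAt []       k       a = refl
length-updateAt (x ∷ xs) zero    a = refl
length-updateAt (x ∷ xs) (suc k) a = cong suc (length-updateAt xs k a)

updateAt-all : ∀ {A : Set} {P : A → Set} xs j z → All P xs → P z → All P (updateAt xs j z)
updateAt-all []       j       z ps       pz = ps
updateAt-all (x ∷ xs) zero    z (_ ∷ ps) pz = pz ∷ ps
updateAt-all (x ∷ xs) (suc j) z (p ∷ ps) pz = p ∷ updateAt-all xs j z ps pz

at-replicate : ∀ {A : Set} k (a b : A) R → at (replicate k a ++ b ∷ R) k ≡ just b
at-replicate zero    a b R = refl
at-replicate (suc k) a b R = at-replicate k a b R

at-replicate-next : ∀ {A : Set} k (a b : A) R → at (replicate k a ++ b ∷ R) (suc k) ≡ at R 0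
at-replicate-next zero    a b R = refl
at-replicate-next (suc k) a b R = at-replicate-next k a b R

at-replicate-beyond : ∀ {A : Set} k (a b : A) R i → at (replicate k a ++ b ∷ R) (suc k + i) ≡ at R i
at-replicate-beyond zero    a b R i = refl
at-replicate-beyond (suc k) a b R i = at-replicate-beyond k a b R i

updateAt-replicate : ∀ {A : Set} k (a b e : A) R → updateAt (replicate k a ++ b ∷ R) k e ≡ replicate k a ++ e ∷ R
updateAt-replicate zero    a b e R = refl
updateAt-replicate (suc k) a b e R = cong (a ∷_) (updateAt-replicate k a b e R)

updateAt-replicate-next : ∀ {A : Set} k (a b c e : A) R →
  updateAt (replicate k a ++ b ∷ c ∷ R) (suc k) e ≡ replicate k a ++ b ∷ e ∷ R
updateAt-replicate-next zero    a b c e R = refl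
updateAt-replicate-next (suc k) a b c e R = cong (a ∷_) (updateAt-replicate-next k a b c e R)

replicate-snoc : ∀ {A : Set} k (a : A) R → replicate k a ++ a ∷ R ≡ a ∷ (replicate k a ++ R)
replicate-snoc zero    a R = refl
replicate-snoc (suc k) a R = cong (a ∷_) (replicate-snoc k a R)

getRow-setRow-zero : ∀ {A : Set} (T : Tab A) new → getRow (setRow T 0 new) 0 ≡ new
getRow-setRow-zero []      new = refl
getRow-setRow-zero (r ∷ T) new = refl

getRow-setRow-suc : ∀ {A : Set} (T : Tab A) r new → getRow (setRow T (suc r) new) 0 ≡ getRow T 0
getRow-setRow-suc []      r new = refl
getRow-setRow-suc (x ∷ T) r new = refl

size-setEntry-zero : ∀ (row : List Letter) rest k e → size (setEntry (row ∷ rest) 0 k e) ≡ size (row ∷ rest)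
size-setEntry-zero row rest k e = cong (_+ size rest) (length-updateAt row k e)

ins-row-append : ∀ f r x T → rowBump x (getRow T r) ≡ nothing →
  ins (suc f) (rowM r) x T ≡ (setRow T r (getRow T r ++ [ x ]) , (r , r + length (getRow T r)))
ins-row-append f r x T eq with rowBump x (getRow T r)
ins-row-append f r x T refl | nothing = refl

ins-row-bump : ∀ f r x T k a → rowBump x (getRow T r) ≡ just (k , a) →
  ins (suc f) (rowM r) x T ≡ ins f (proj₁ (afterBump r (r + k) a)) (proj₂ (afterBump r (r + k) a)) (setEntry T r k x)
ins-row-bump f r x T k a eq with rowBump x (getRow T r)
ins-row-bump f r x T k a refl | just _ = refl

ins-col-append : ∀ f c x T r → colFind x c 0 T ≡ appendAt r →
  ins (suc f) (colM c) x T ≡ (setRow T r (getRow T r ++ [ x ]) , (r , c))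
ins-col-append f c x T r eq with colFind x c 0 T
ins-col-append f c x T r refl | appendAt _ = refl

ins-col-bump : ∀ f c x T r a → colFind x c 0 T ≡ bumpAt r a →
  ins (suc f) (colM c) x T ≡ ins f (proj₁ (afterBump r c a)) (proj₂ (afterBump r c a)) (setEntry T r (c ∸ r) x)
ins-col-bump f c x T r a eq with colFind x c 0 T
ins-col-bump f c x T r a refl | bumpAt _ _ = refl

rowBump-sound : ∀ x row k a → rowBump x row ≡ just (k , a) → at row k ≡ just a × code x < code a
rowBump-sound x [] k a ()
rowBump-sound x (y ∷ row) k a eq with code x <ᵇ code y in lt
rowBump-sound x (y ∷ row) k a refl | true = refl , <ᵇ-true⇒< lt
rowBump-sound x (y ∷ row) k a eq | false with rowBump x row in eqr
rowBump-sound x (y ∷ row) k a () | false | nothing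
rowBump-sound x (y ∷ row) .(suc k') .a' refl | false | just (k' , a') = rowBump-sound x row k' a' eqr

colFind-sound : ∀ x c r rows r' y → colFind x c r rows ≡ bumpAt r' y →
  ∃[ d ] (r' ≡ r + d × at (getRow rows d) (c ∸ r') ≡ just y × code x < code y)
colFind-sound x c r [] r' y ()
colFind-sound x c r (row ∷ rows) r' y eq with r ≤ᵇ c | at row (c ∸ r) in eqa
... | true | just z with code x <ᵇ code z in lt
...   | true with eq
...     | refl = 0 , sym (+-identityʳ r) , eqa , <ᵇ-true⇒< lt
colFind-sound x c r (row ∷ rows) r' y eq | true | just z | false
  with colFind-sound x c (suc r) rows r' y eq
... | d , e1 , e2 , e3 = suc d , trans e1 (sym (+-suc r d)) , e2 , e3
colFind-sound x c r (row ∷ rows) r' y () | true | nothing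
colFind-sound x c r (row ∷ rows) r' y () | false | _

colFind-bump-sound : ∀ x c T r y → colFind x c 0 T ≡ bumpAt r y →
  at (getRow T r) (c ∸ r) ≡ just y × code x < code y
colFind-bump-sound x c T r y eq with colFind-sound x c 0 T r y eq
... | d , refl , e2 , e3 = e2 , e3

colFind₀ : Letter → ℕ → Maybe Letter → Tab Letter → ColRes
colFind₀ x c (just y) rest = if code x <ᵇ code y then bumpAt 0 y else colFind x c 1 rest
colFind₀ x c nothing  rest = appendAt 0

colFind-first-row : ∀ x c row rest → colFind x c 0 (row ∷ rest) ≡ colFind₀ x c (at row c) rest
colFind-first-row x c row rest with at row c
... | just y  = refl
... | nothing = refl

afterBump-bound : ∀ r c a t → t < code a → t ≤ code (proj₂ (afterBump r c a))
afterBump-bound r c a t p with r ≡ᵇ c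
afterBump-bound r c (unp i) t p | true  = ≤-pred p
afterBump-bound r c (pri i) t p | true  = <⇒≤ p
afterBump-bound r c (unp i) t p | false = <⇒≤ p
afterBump-bound r c (pri i) t p | false = <⇒≤ p

afterBump-offdiag : ∀ j a → proj₂ (afterBump 0 (suc j) a) ≡ a
afterBump-offdiag j (unp i) = refl
afterBump-offdiag j (pri i) = refl

rowBump-head : ∀ x a R → code x < code a → rowBump x (a ∷ R) ≡ just (0 , a)
rowBump-head x a R lt rewrite <⇒<ᵇ-true lt = refl

rowBump-over-ones : ∀ x k R → 3 ≤ code x →
  rowBump x (replicate k (unp 1) ++ R) ≡ Maybe.map (λ p → k + proj₁ p , proj₂ p) (rowBump x R)
rowBump-over-ones x zero R p with rowBump x R
... | just _  = refl
... | nothing = refl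
rowBump-over-ones x (suc k) R p rewrite ≥⇒<ᵇ-false {code x} {3} p | rowBump-over-ones x k R p with rowBump x R
... | just _  = refl
... | nothing = refl

rowBump-updateAt : ∀ x row k a e → at row k ≡ just a → code a ≤ code x → code e ≤ code x →
  rowBump x (updateAt row k e) ≡ rowBump x row
rowBump-updateAt x (y ∷ row) zero    .y e refl p q rewrite ≥⇒<ᵇ-false p | ≥⇒<ᵇ-false q = refl
rowBump-updateAt x (y ∷ row) (suc k) a  e eq   p q rewrite rowBump-updateAt x row k a e eq p q = refl

-- The fuel never runs out.  Along a bumping path an entry y > x is replaced
-- by x and the travelling letter does not decrease, so the number of entries
-- exceeding the travelling letter strictly drops; it bounds the path length.

countRow : ℕ → List Letter → ℕ
countRow v []       = 0
countRow v (a ∷ as) = if v <ᵇ code a then suc (countRow v as) else countRow v as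

countAbove : ℕ → Tab Letter → ℕ
countAbove v []      = 0
countAbove v (r ∷ T) = countRow v r + countAbove v T

countRow-updateAt : ∀ v row k y z → at row k ≡ just y → v < code y → code z ≤ v →
  suc (countRow v (updateAt row k z)) ≡ countRow v row
countRow-updateAt v (a ∷ row) zero .a z refl p q rewrite <⇒<ᵇ-true p | ≥⇒<ᵇ-false q = refl
countRow-updateAt v (a ∷ row) (suc k) y z eq p q with v <ᵇ code a
... | true  = cong suc (countRow-updateAt v row k y z eq p q)
... | false = countRow-updateAt v row k y z eq p q

countRow-antitone : ∀ v w row → v ≤ w → countRow w row ≤ countRow v row
countRow-antitone v w [] p = z≤n
countRow-antitone v w (a ∷ row) p with w <ᵇ code a in e1 | v <ᵇ code a in e2
... | true  | true  = s≤s (countRow-antitone v w row p)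
... | true  | false = ⊥-elim (<⇒≱ (≤-<-trans p (<ᵇ-true⇒< {w} {code a} e1)) (<ᵇ-false⇒≥ {v} {code a} e2))
... | false | true  = m≤n⇒m≤1+n (countRow-antitone v w row p)
... | false | false = countRow-antitone v w row p

countAbove-antitone : ∀ v w T → v ≤ w → countAbove w T ≤ countAbove v T
countAbove-antitone v w []      p = z≤n
countAbove-antitone v w (r ∷ T) p = +-mono-≤ (countRow-antitone v w r p) (countAbove-antitone v w T p)

countAbove-setEntry : ∀ v T r k y z → at (getRow T r) k ≡ just y → v < code y → code z ≤ v →
  suc (countAbove v (setEntry T r k z)) ≡ countAbove v T
countAbove-setEntry v [] zero    k y z () p q
countAbove-setEntry v [] (suc r) k y z () p q
countAbove-setEntry v (row ∷ T) zero    k y z eq p q = cong (_+ countAbove v T) (countRow-updateAt v row k y z eq p q)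
countAbove-setEntry v (row ∷ T) (suc r) k y z eq p q =
  trans (sym (+-suc (countRow v row) _)) (cong (countRow v row +_) (countAbove-setEntry v T r k y z eq p q))

countRow-length : ∀ v row → countRow v row ≤ length row
countRow-length v [] = z≤n
countRow-length v (a ∷ row) with v <ᵇ code a
... | true  = s≤s (countRow-length v row)
... | false = m≤n⇒m≤1+n (countRow-length v row)

countAbove-size : ∀ v T → countAbove v T ≤ size T
countAbove-size v []      = z≤n
countAbove-size v (r ∷ T) = +-mono-≤ (countRow-length v r) (countAbove-size v T)

bump-decreases : ∀ x x' T T' f → code x ≤ code x' → suc (countAbove (code x) T') ≡ countAbove (code x) T →
  countAbove (code x) T < suc f → countAbove (code x') T' < f
bump-decreases x x' T T' f le e lt =
  ≤-trans (s≤s (countAbove-antitone (code x) (code x') T' le)) (≤-trans (≤-reflexive e) (≤-pred lt))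

ins-fuel-irrelevant : ∀ f g m x T → countAbove (code x) T < f → countAbove (code x) T < g →
  proj₁ (ins f m x T) ≡ proj₁ (ins g m x T)
ins-fuel-irrelevant zero    g       m x T () q
ins-fuel-irrelevant (suc f) zero    m x T p ()
ins-fuel-irrelevant (suc f) (suc g) (rowM r) x T p q with rowBump x (getRow T r) in eq
... | nothing      = refl
... | just (k , a) =
  let (at-k , x<a) = rowBump-sound x (getRow T r) k a eq
      x' = proj₂ (afterBump r (r + k) a)
      T' = setEntry T r k x
      le = afterBump-bound r (r + k) a (code x) x<a
      ce = countAbove-setEntry (code x) T r k a x at-k x<a ≤-refl
  in ins-fuel-irrelevant f g (proj₁ (afterBump r (r + k) a)) x' T'
       (bump-decreases x x' T T' f le ce p) (bump-decreases x x' T T' g le ce q)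
ins-fuel-irrelevant (suc f) (suc g) (colM c) x T p q with colFind x c 0 T in eq
... | appendAt r = refl
... | bumpAt r a =
  let (at-r , x<a) = colFind-bump-sound x c T r a eq
      x' = proj₂ (afterBump r c a)
      T' = setEntry T r (c ∸ r) x
      le = afterBump-bound r c a (code x) x<a
      ce = countAbove-setEntry (code x) T r (c ∸ r) a x at-r x<a ≤-refl
  in ins-fuel-irrelevant f g (proj₁ (afterBump r c a)) x' T'
       (bump-decreases x x' T T' f le ce p) (bump-decreases x x' T T' g le ce q)

insertLetter : Tab Letter → ℕ → Tab Letter
insertLetter T b = proj₁ (ins (fuel T) (rowM 0) (unp b) T)

insertWord : Tab Letter → List ℕ → Tab Letter
insertWord T []       = T
insertWord T (b ∷ bs) = insertWord (insertLetter T b) bs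

insertWord-++ : ∀ T u w → insertWord T (u ++ w) ≡ insertWord (insertWord T u) w
insertWord-++ T []      w = refl
insertWord-++ T (b ∷ u) w = insertWord-++ (insertLetter T b) u w

hmFrom-insertWord : ∀ i T Q w → proj₁ (hmFrom i (T , Q) w) ≡ insertWord T w
hmFrom-insertWord i T Q [] = refl
hmFrom-insertWord i T Q (b ∷ bs) with ins (fuel T) (rowM 0) (unp b) T
... | T' , (r , c) = hmFrom-insertWord (suc i) T' (setRow Q r (getRow Q r ++ [ i ])) bs

PHM-insertWord : ∀ b → PHM b ≡ insertWord [] b
PHM-insertWord b = hmFrom-insertWord 1 [] [] b

fuel-large : ∀ T → ∃[ g ] (fuel T ≡ suc (suc g) × size T < g)
fuel-large T = size T + suc (size T) * suc (suc (size T)) ,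
  cong (λ z → z * z) (+-comm (size T) 2) , m<m+n (size T) {suc (size T) * suc (suc (size T))} (s≤s z≤n)

insertLetter-fuel : ∀ T b g → fuel T ≡ g → insertLetter T b ≡ proj₁ (ins g (rowM 0) (unp b) T)
insertLetter-fuel T b g e = cong (λ f → proj₁ (ins f (rowM 0) (unp b) T)) e

fuel-setEntry-zero : ∀ (row : List Letter) rest k e → fuel (setEntry (row ∷ rest) 0 k e) ≡ fuel (row ∷ rest)
fuel-setEntry-zero row rest k e = cong (λ s → (s + 2) * (s + 2)) (size-setEntry-zero row rest k e)

-- Letters ≥ 2 leave a small prefix of the first row alone.
-- Codes: 1 ↦ 3, 2' ↦ 4, 2 ↦ 5, 3' ↦ 6; a letter is ≥ 2 iff its code is ≥ 5.

3≤5 : 3 ≤ 5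
3≤5 = s≤s (s≤s (s≤s z≤n))

4≤5 : 4 ≤ 5
4≤5 = s≤s (s≤s (s≤s (s≤s z≤n)))

AtLeast : ℕ → List Letter → Set
AtLeast t R = All (λ a → t ≤ code a) R

AtMost : ℕ → List Letter → Set
AtMost t P = All (λ a → code a ≤ t) P

FirstRow : List Letter → ℕ → Tab Letter → Set
FirstRow P t Z = ∃[ R ] (getRow Z 0 ≡ P ++ R × AtLeast t R)

FirstRow-transport : ∀ {P t Z Z'} → Z ≡ Z' → FirstRow P t Z' → FirstRow P t Z
FirstRow-transport refl fr = fr

FirstRow-append : ∀ {P t} T x → FirstRow P t T → t ≤ code x → FirstRow P t (setRow T 0 (getRow T 0 ++ [ x ]))
FirstRow-append {P} T x (R , e , g) h =
  R ++ [ x ] , trans (getRow-setRow-zero T _) (trans (cong (_++ [ x ]) e) (++-assoc P R [ x ])) , ++⁺ g (h ∷ [])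

FirstRow-setRow-suc : ∀ {P t} T r new → FirstRow P t T → FirstRow P t (setRow T (suc r) new)
FirstRow-setRow-suc T r new (R , e , g) = R , trans (getRow-setRow-suc T r new) e , g

replace-in-suffix : ∀ {t} P R j {a} z → AtMost t P → AtLeast t R → at (P ++ R) j ≡ just a → t < code a →
  t ≤ code z → ∃[ R' ] (updateAt (P ++ R) j z ≡ P ++ R' × AtLeast t R')
replace-in-suffix []      R j       z lp         g e    lt h = updateAt R j z , refl , updateAt-all R j z g h
replace-in-suffix (p ∷ P) R zero    z (p≤t ∷ _)  g refl lt h = ⊥-elim (<⇒≱ lt p≤t)
replace-in-suffix (p ∷ P) R (suc j) z (_ ∷ lp)   g e    lt h with replace-in-suffix P R j z lp g e lt h
... | R' , e' , g' = R' , cong (p ∷_) e' , g'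

FirstRow-replace : ∀ {P t} T j {a} x → AtMost t P → FirstRow P t T → at (getRow T 0) j ≡ just a → t < code a →
  t ≤ code x → FirstRow P t (setEntry T 0 j x)
FirstRow-replace {P} T j x lp (R , e , g) at-j lt h
  with replace-in-suffix P R j x lp g (subst (λ row → at row j ≡ just _) e at-j) lt h
... | R' , e' , g' = R' , trans (getRow-setRow-zero T _) (trans (cong (λ row → updateAt row j x) e) e') , g'

-- Inserting a letter of code ≥ t keeps the first row of the form P R with R ≥ t:
-- every bumped entry exceeds the letter, so it lies in R.
insert-keeps-prefix : ∀ {P t} → AtMost t P → ∀ f m x T → FirstRow P t T → t ≤ code x →
  FirstRow P t (proj₁ (ins f m x T))
insert-keeps-prefix lp zero m x T fr h = fr
insert-keeps-prefix lp (suc f) (rowM zero) x T fr h with rowBump x (getRow T 0) in eq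
... | nothing      = FirstRow-append T x fr h
... | just (j , a) =
  let (at-j , x<a) = rowBump-sound x (getRow T 0) j a eq
      t<a = ≤-<-trans h x<a
  in insert-keeps-prefix lp f _ _ (setEntry T 0 j x) (FirstRow-replace T j x lp fr at-j t<a h)
       (afterBump-bound 0 j a _ t<a)
insert-keeps-prefix lp (suc f) (rowM (suc r)) x T fr h with rowBump x (getRow T (suc r)) in eq
... | nothing      = FirstRow-setRow-suc T r _ fr
... | just (j , a) =
  insert-keeps-prefix lp f _ _ (setEntry T (suc r) j x) (FirstRow-setRow-suc T r _ fr)
    (afterBump-bound (suc r) (suc r + j) a _ (≤-<-trans h (proj₂ (rowBump-sound x (getRow T (suc r)) j a eq))))
insert-keeps-prefix lp (suc f) (colM c) x T fr h with colFind x c 0 T in eq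
... | appendAt zero    = FirstRow-append T x fr h
... | appendAt (suc r) = FirstRow-setRow-suc T r _ fr
... | bumpAt zero a    =
  let (at-c , x<a) = colFind-bump-sound x c T 0 a eq
      t<a = ≤-<-trans h x<a
  in insert-keeps-prefix lp f _ _ (setEntry T 0 c x) (FirstRow-replace T c x lp fr at-c t<a h)
       (afterBump-bound 0 c a _ t<a)
... | bumpAt (suc r) a =
  insert-keeps-prefix lp f _ _ (setEntry T (suc r) (c ∸ suc r) x) (FirstRow-setRow-suc T r _ fr)
    (afterBump-bound (suc r) c a _ (≤-<-trans h (proj₂ (colFind-bump-sound x c T (suc r) a eq))))

insertWord-keeps-prefix : ∀ {P t} → AtMost t P → ∀ T w → FirstRow P t T → All (λ b → t ≤ code (unp b)) w →
  FirstRow P t (insertWord T w)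
insertWord-keeps-prefix lp T []      fr []       = fr
insertWord-keeps-prefix lp T (b ∷ w) fr (h ∷ hs) =
  insertWord-keeps-prefix lp (insertLetter T b) w (insert-keeps-prefix lp (fuel T) (rowM 0) (unp b) T fr h) hs

-- Letters ≥ 2 commute with replacing a 1 of the first row by a letter ≤ 2:
-- neither the 1 nor its replacement is ever bumped.

bump-avoids-one : ∀ (row : List Letter) j k x a → at row j ≡ just a → code x < code a → 5 ≤ code x →
  at row k ≡ just (unp 1) → j ≢ k
bump-avoids-one row j k x a at-j x<a x≥5 at-k refl with trans (sym at-j) at-k
... | refl = <⇒≱ x<a (≤-trans 3≤5 x≥5)

colFind-updateAt : ∀ x c row rest k e → 5 ≤ code x → at row k ≡ just (unp 1) → code e ≤ 5 →
  colFind x c 0 (updateAt row k e ∷ rest) ≡ colFind x c 0 (row ∷ rest)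
colFind-updateAt x c row rest k e x≥5 at-k e≤5 =
  trans (colFind-first-row x c (updateAt row k e) rest) (trans same (sym (colFind-first-row x c row rest)))
  where
  same : colFind₀ x c (at (updateAt row k e) c) rest ≡ colFind₀ x c (at row c) rest
  same with k ≟ c
  ... | yes refl rewrite at-updateAt-same row k e at-k | at-k
                       | ≥⇒<ᵇ-false {code x} {code e} (≤-trans e≤5 x≥5) | ≥⇒<ᵇ-false {code x} {3} (≤-trans 3≤5 x≥5) = refl
  ... | no k≢c rewrite at-updateAt-other row k c e k≢c = refl

SetEntryComm : ℕ → Letter → ℕ → Set
SetEntryComm k e f = ∀ m x T → 5 ≤ code x → at (getRow T 0) k ≡ just (unp 1) →
  proj₁ (ins f m x (setEntry T 0 k e)) ≡ setEntry (proj₁ (ins f m x T)) 0 k e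

-- the step where x bumps the entry a at position j of the first row: j ≠ k, so
-- the two replacements commute and the bumped letter continues on both sides
first-row-bump-comm : ∀ {k e} f → SetEntryComm k e f → ∀ row rest j a x → at row j ≡ just a → code x < code a →
  5 ≤ code x → at row k ≡ just (unp 1) →
  proj₁ (ins f (proj₁ (afterBump 0 j a)) (proj₂ (afterBump 0 j a)) (setEntry (updateAt row k e ∷ rest) 0 j x))
    ≡ setEntry (proj₁ (ins f (proj₁ (afterBump 0 j a)) (proj₂ (afterBump 0 j a)) (updateAt row j x ∷ rest))) 0 k e
first-row-bump-comm {k} {e} f continue row rest j a x at-j x<a x≥5 at-k =
  trans (cong (λ z → proj₁ (ins f (proj₁ (afterBump 0 j a)) (proj₂ (afterBump 0 j a)) (z ∷ rest)))
              (updateAt-comm row k j e x (j≢k ∘ sym)))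
        (continue _ _ (updateAt row j x ∷ rest) (afterBump-bound 0 j a 5 (≤-<-trans x≥5 x<a))
                  (trans (at-updateAt-other row j k x j≢k) at-k))
  where
  j≢k : j ≢ k
  j≢k = bump-avoids-one row j k x a at-j x<a x≥5 at-k

insert-setEntry-comm : ∀ k e → code e ≤ 5 → ∀ f → SetEntryComm k e f
insert-setEntry-comm k e e≤5 f       m x [] x≥5 ()
insert-setEntry-comm k e e≤5 zero    m x (row ∷ rest) x≥5 at-k = refl
insert-setEntry-comm k e e≤5 (suc f) (rowM zero) x (row ∷ rest) x≥5 at-k
  with rowBump-updateAt x row k (unp 1) e at-k (≤-trans 3≤5 x≥5) (≤-trans e≤5 x≥5) | rowBump x row in eq
... | same | nothing =
  trans (cong proj₁ (ins-row-append f 0 x (updateAt row k e ∷ rest) (trans same eq)))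
        (cong (_∷ rest) (updateAt-++ row [ x ] k e at-k))
... | same | just (j , a) =
  let (at-j , x<a) = rowBump-sound x row j a eq
  in trans (cong proj₁ (ins-row-bump f 0 x (updateAt row k e ∷ rest) j a (trans same eq)))
           (first-row-bump-comm f (insert-setEntry-comm k e e≤5 f) row rest j a x at-j x<a x≥5 at-k)
insert-setEntry-comm k e e≤5 (suc f) (rowM (suc r)) x (row ∷ rest) x≥5 at-k with rowBump x (getRow rest r) in eq
... | nothing      = refl
... | just (j , a) =
  insert-setEntry-comm k e e≤5 f _ _ (row ∷ setEntry rest r j x)
    (afterBump-bound (suc r) (suc r + j) a 5 (≤-<-trans x≥5 (proj₂ (rowBump-sound x (getRow rest r) j a eq)))) at-k
insert-setEntry-comm k e e≤5 (suc f) (colM c) x (row ∷ rest) x≥5 at-k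
  with colFind-updateAt x c row rest k e x≥5 at-k e≤5 | colFind x c 0 (row ∷ rest) in eq
... | same | appendAt zero =
  trans (cong proj₁ (ins-col-append f c x (updateAt row k e ∷ rest) 0 (trans same eq)))
        (cong (_∷ rest) (updateAt-++ row [ x ] k e at-k))
... | same | appendAt (suc r) = cong proj₁ (ins-col-append f c x (updateAt row k e ∷ rest) (suc r) (trans same eq))
... | same | bumpAt zero a =
  let (at-c , x<a) = colFind-bump-sound x c (row ∷ rest) 0 a eq
  in trans (cong proj₁ (ins-col-bump f c x (updateAt row k e ∷ rest) 0 a (trans same eq)))
           (first-row-bump-comm f (insert-setEntry-comm k e e≤5 f) row rest c a x at-c x<a x≥5 at-k)
... | same | bumpAt (suc r) a =
  trans (cong proj₁ (ins-col-bump f c x (updateAt row k e ∷ rest) (suc r) a (trans same eq)))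
    (insert-setEntry-comm k e e≤5 f _ _ (row ∷ setEntry rest r (c ∸ suc r) x)
       (afterBump-bound (suc r) c a 5 (≤-<-trans x≥5 (proj₂ (colFind-bump-sound x c (row ∷ rest) (suc r) a eq)))) at-k)

ones : ℕ → List Letter
ones k = replicate k (unp 1)

ones-small : ∀ t k → 3 ≤ t → AtMost t (ones k)
ones-small t zero    h = []
ones-small t (suc k) h = h ∷ ones-small t k h

code-≥2 : ∀ b → 2 ≤ b → 5 ≤ code (unp b)
code-≥2 b p = s≤s (*-monoʳ-≤ 2 p)

code-≥3 : ∀ b → 3 ≤ b → 6 ≤ code (unp b)
code-≥3 b p = m≤n⇒m≤1+n (*-monoʳ-≤ 2 p)

2'-appends-after-ones : ∀ j rest → colFind (pri 2) (suc j) 0 ((ones j ++ unp 1 ∷ []) ∷ rest) ≡ appendAt 0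
2'-appends-after-ones j rest =
  trans (colFind-first-row (pri 2) (suc j) (ones j ++ unp 1 ∷ []) rest)
        (cong (λ z → colFind₀ (pri 2) (suc j) z rest) (at-replicate-next j (unp 1) (unp 1) []))

2'-bumps-after-ones : ∀ j a R rest → 5 ≤ code a → colFind (pri 2) (suc j) 0 ((ones j ++ unp 1 ∷ a ∷ R) ∷ rest) ≡ bumpAt 0 a
2'-bumps-after-ones j a R rest a≥5 =
  trans (colFind-first-row (pri 2) (suc j) (ones j ++ unp 1 ∷ a ∷ R) rest)
    (trans (cong (λ z → colFind₀ (pri 2) (suc j) z rest) (at-replicate-next j (unp 1) (unp 1) (a ∷ R)))
           (cong (λ b → if b then bumpAt 0 a else colFind (pri 2) (suc j) 1 rest) (<⇒<ᵇ-true {4} {code a} a≥5)))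

1-bumps-after-ones : ∀ k a R → 4 ≤ code a → rowBump (unp 1) (ones k ++ unp 1 ∷ a ∷ R) ≡ just (suc k , a)
1-bumps-after-ones k a R a≥4 = trans (rowBump-over-ones (unp 1) k (unp 1 ∷ a ∷ R) ≤-refl)
  (trans (cong (λ r → Maybe.map (λ p → k + proj₁ p , proj₂ p) (Maybe.map (λ p → suc (proj₁ p) , proj₂ p) r))
               (rowBump-head (unp 1) a R a≥4))
         (cong (λ z → just (z , a)) (+-comm k 1)))

insert-2'-after-ones : ∀ f T j R → getRow T 0 ≡ ones j ++ unp 1 ∷ R → AtLeast 5 R →
  FirstRow (ones j ++ unp 1 ∷ pri 2 ∷ []) 5 (proj₁ (ins (suc f) (colM (suc j)) (pri 2) T))
insert-2'-after-ones f [] zero    R () _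
insert-2'-after-ones f [] (suc j) R () _
insert-2'-after-ones f (row ∷ rest) j [] refl [] =
  FirstRow-transport (cong proj₁ (ins-col-append f (suc j) (pri 2) (row ∷ rest) 0 (2'-appends-after-ones j rest)))
    ([] , trans (++-assoc (ones j) _ _) (sym (++-identityʳ _)) , [])
insert-2'-after-ones f (row ∷ rest) j (a ∷ R) refl (a≥5 ∷ R≥5) =
  FirstRow-transport (cong proj₁ (ins-col-bump f (suc j) (pri 2) (row ∷ rest) 0 a (2'-bumps-after-ones j a R rest a≥5)))
    (insert-keeps-prefix (++⁺ (ones-small 5 j 3≤5) (3≤5 ∷ 4≤5 ∷ [])) f _ _ (updateAt row (suc j) (pri 2) ∷ rest)
       (R , trans (updateAt-replicate-next j (unp 1) (unp 1) a (pri 2) R) (sym (++-assoc (ones j) _ R)) , R≥5)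
       (subst (λ z → 5 ≤ code z) (sym (afterBump-offdiag j a)) a≥5))

TwoFirst : Tab Letter → Set
TwoFirst T = FirstRow (unp 2 ∷ []) 5 T ⊎ ∃[ j ] FirstRow (ones j ++ unp 1 ∷ pri 2 ∷ []) 5 T

twoFirst-init : ∀ T → FirstRow [] 6 T → FirstRow (unp 2 ∷ []) 5 (insertLetter T 2)
twoFirst-init T fr with fuel-large T
twoFirst-init T ([] , e , _) | g , fe , _ =
  FirstRow-transport (trans (insertLetter-fuel T 2 _ fe)
                       (cong proj₁ (ins-row-append (suc g) 0 (unp 2) T (cong (rowBump (unp 2)) e))))
    ([] , trans (getRow-setRow-zero T _) (cong (_++ [ unp 2 ]) e) , [])
twoFirst-init T ((a ∷ R) , e , (a≥6 ∷ R≥6)) | g , fe , _ =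
  FirstRow-transport (trans (insertLetter-fuel T 2 _ fe) (cong proj₁ (ins-row-bump (suc g) 0 (unp 2) T 0 a bumps)))
    (insert-keeps-prefix (≤-refl ∷ []) (suc g) (colM 1) (prime a) (setEntry T 0 0 (unp 2))
       (R , trans (getRow-setRow-zero T _) (cong (λ z → updateAt z 0 (unp 2)) e) , All.map (≤-trans (n≤1+n 5)) R≥6)
       (afterBump-bound 0 0 a 5 a≥6))
  where
  bumps : rowBump (unp 2) (getRow T 0) ≡ just (0 , a)
  bumps = trans (cong (rowBump (unp 2)) e) (rowBump-head (unp 2) a R a≥6)

twoFirst-step : ∀ T b → 1 ≤ b → TwoFirst T → TwoFirst (insertLetter T b)
twoFirst-step T (suc (suc b)) _ (inj₁ fr) =
  inj₁ (insert-keeps-prefix (≤-refl ∷ []) (fuel T) (rowM 0) _ T fr (code-≥2 (suc (suc b)) (s≤s (s≤s z≤n))))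
twoFirst-step T (suc (suc b)) _ (inj₂ (j , fr)) =
  inj₂ (j , insert-keeps-prefix (++⁺ (ones-small 5 j 3≤5) (3≤5 ∷ 4≤5 ∷ [])) (fuel T) (rowM 0) _ T fr
              (code-≥2 (suc (suc b)) (s≤s (s≤s z≤n))))
-- 1 bumps the diagonal 2, which moves on as 2' into column 1
twoFirst-step T (suc zero) _ (inj₁ (R , e , R≥5)) with fuel-large T
... | g , fe , _ =
  inj₂ (0 , FirstRow-transport
              (trans (insertLetter-fuel T 1 _ fe) (cong proj₁ (ins-row-bump (suc g) 0 (unp 1) T 0 (unp 2) (cong (rowBump (unp 1)) e))))
              (insert-2'-after-ones g (setEntry T 0 0 (unp 1)) 0 R
                 (trans (getRow-setRow-zero T _) (cong (λ z → updateAt z 0 (unp 1)) e)) R≥5))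
-- 1 joins the run of 1's, bumping the 2', which moves one column to the right
twoFirst-step T (suc zero) _ (inj₂ (j , R , e , R≥5)) with fuel-large T
... | g , fe , _ =
  inj₂ (suc j , FirstRow-transport
                  (trans (insertLetter-fuel T 1 _ fe) (cong proj₁ (ins-row-bump (suc g) 0 (unp 1) T (suc j) (pri 2) bumps)))
                  (insert-2'-after-ones g (setEntry T 0 (suc j) (unp 1)) (suc j) R row' R≥5))
  where
  row : getRow T 0 ≡ ones j ++ unp 1 ∷ pri 2 ∷ R
  row = trans e (++-assoc (ones j) _ R)
  bumps : rowBump (unp 1) (getRow T 0) ≡ just (suc j , pri 2)
  bumps = trans (cong (rowBump (unp 1)) row) (1-bumps-after-ones j (pri 2) R ≤-refl)
  row' : getRow (setEntry T 0 (suc j) (unp 1)) 0 ≡ ones (suc j) ++ unp 1 ∷ R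
  row' = trans (getRow-setRow-zero T _)
           (trans (cong (λ z → updateAt z (suc j) (unp 1)) row)
             (trans (updateAt-replicate-next j (unp 1) (unp 1) (pri 2) (unp 1) R) (replicate-snoc j (unp 1) (unp 1 ∷ R))))

twoFirst-word : ∀ T w → All (1 ≤_) w → TwoFirst T → TwoFirst (insertWord T w)
twoFirst-word T []      _        s = s
twoFirst-word T (b ∷ w) (h ∷ hs) s = twoFirst-word (insertLetter T b) w hs (twoFirst-step T b h s)

raise : ℕ → Letter
raise zero    = unp 2
raise (suc _) = pri 2

raise-small : ∀ k → code (raise k) ≤ 5
raise-small zero    = ≤-refl
raise-small (suc k) = 4≤5

OnesRow : Tab Letter → ℕ → Set
OnesRow T k = ∃[ R ] (getRow T 0 ≡ ones k ++ unp 1 ∷ R × AtLeast 5 R)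

Raised : Tab Letter → Tab Letter → ℕ → Set
Raised T T' k = OnesRow T k × T' ≡ setEntry T 0 k (raise k)

FirstRow⇒OnesRow : ∀ k T → FirstRow (ones k ++ unp 1 ∷ []) 5 T → OnesRow T k
FirstRow⇒OnesRow k T (R , e , g) = R , trans e (++-assoc (ones k) _ R) , g

FirstRow⇒OnesRow-suc : ∀ k T → FirstRow (ones k ++ unp 1 ∷ unp 1 ∷ []) 5 T → OnesRow T (suc k)
FirstRow⇒OnesRow-suc k T (R , e , g) =
  R , trans e (trans (++-assoc (ones k) _ R) (replicate-snoc k (unp 1) (unp 1 ∷ R))) , g

raised-init : ∀ T → FirstRow [] 6 T → Raised (insertLetter T 1) (insertLetter T 2) 0
raised-init T fr with fuel-large T
raised-init [] ([] , refl , _) | g , fe , _ =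
  ([] , cong (λ Z → getRow Z 0) (insertLetter-fuel [] 1 _ fe) , [])
  , trans (insertLetter-fuel [] 2 _ fe) (cong (λ Z → setEntry Z 0 0 (unp 2)) (sym (insertLetter-fuel [] 1 _ fe)))
raised-init (row ∷ rest) ([] , refl , _) | g , fe , _ =
  ([] , cong (λ Z → getRow Z 0) (insertLetter-fuel (row ∷ rest) 1 _ fe) , [])
  , trans (insertLetter-fuel (row ∷ rest) 2 _ fe) (cong (λ Z → setEntry Z 0 0 (unp 2)) (sym (insertLetter-fuel (row ∷ rest) 1 _ fe)))
raised-init [] ((a ∷ R) , () , _) | g , fe , _
raised-init (row ∷ rest) ((a ∷ R) , refl , (a≥6 ∷ R≥6)) | g , fe , _ =
  FirstRow⇒OnesRow 0 (insertLetter T 1) (FirstRow-transport ins₁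
    (insert-keeps-prefix (3≤5 ∷ []) (suc g) (colM 1) (prime a) T₁ (R , refl , All.map (≤-trans (n≤1+n 5)) R≥6) a'≥5))
  , trans ins₂ (trans (insert-setEntry-comm 0 (unp 2) ≤-refl (suc g) (colM 1) (prime a) T₁ a'≥5 refl)
                      (cong (λ z → setEntry z 0 0 (unp 2)) (sym ins₁)))
  where
  T : Tab Letter
  T = (a ∷ R) ∷ rest
  T₁ : Tab Letter
  T₁ = (unp 1 ∷ R) ∷ rest
  a'≥5 : 5 ≤ code (proj₂ (afterBump 0 0 a))
  a'≥5 = afterBump-bound 0 0 a 5 a≥6
  ins₁ : insertLetter T 1 ≡ proj₁ (ins (suc g) (colM 1) (prime a) T₁)
  ins₁ = trans (insertLetter-fuel T 1 _ fe)
           (cong proj₁ (ins-row-bump (suc g) 0 (unp 1) T 0 a (rowBump-head (unp 1) a R (≤-trans (m≤n⇒m≤1+n 4≤5) a≥6))))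
  ins₂ : insertLetter T 2 ≡ proj₁ (ins (suc g) (colM 1) (prime a) (setEntry T₁ 0 0 (unp 2)))
  ins₂ = trans (insertLetter-fuel T 2 _ fe) (cong proj₁ (ins-row-bump (suc g) 0 (unp 2) T 0 a (rowBump-head (unp 2) a R a≥6)))

-- Inserting 1 into the raised tableau first bumps the raised letter back out
-- (restoring the 1); that letter then moves as 2' into column k+1.
raised-insert-one : ∀ g k R rest → let row = ones k ++ unp 1 ∷ R ; T' = updateAt row k (raise k) ∷ rest in
  fuel T' ≡ suc (suc g) → insertLetter T' 1 ≡ proj₁ (ins (suc g) (colM (suc k)) (pri 2) (row ∷ rest))
raised-insert-one g k R rest fe =
  trans (insertLetter-fuel T' 1 _ fe)
    (trans (cong proj₁ (ins-row-bump (suc g) 0 (unp 1) T' k (raise k) bumps))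
      (trans (cong (λ p → proj₁ (ins (suc g) (proj₁ p) (proj₂ p) (setEntry T' 0 k (unp 1)))) (moves-right k))
             (cong (λ Z → proj₁ (ins (suc g) (colM (suc k)) (pri 2) Z)) restored)))
  where
  row : List Letter
  row = ones k ++ unp 1 ∷ R
  T' : Tab Letter
  T' = updateAt row k (raise k) ∷ rest
  bumps-first : ∀ k → rowBump (unp 1) (raise k ∷ R) ≡ just (0 , raise k)
  bumps-first zero    = refl
  bumps-first (suc k) = refl
  moves-right : ∀ k → afterBump 0 k (raise k) ≡ (colM (suc k) , pri 2)
  moves-right zero    = refl
  moves-right (suc k) = refl
  bumps : rowBump (unp 1) (getRow T' 0) ≡ just (k , raise k)
  bumps = trans (cong (rowBump (unp 1)) (updateAt-replicate k (unp 1) (unp 1) (raise k) R))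
            (trans (rowBump-over-ones (unp 1) k (raise k ∷ R) ≤-refl)
              (trans (cong (Maybe.map (λ p → k + proj₁ p , proj₂ p)) (bumps-first k))
                     (cong (λ z → just (z , raise k)) (+-identityʳ k))))
  restored : setEntry T' 0 k (unp 1) ≡ row ∷ rest
  restored = cong (_∷ rest) (trans (updateAt-idem row k (raise k) (unp 1))
                                   (updateAt-self row k (at-replicate k (unp 1) (unp 1) R)))

-- inserting 1 when the run of 1's ends the first row: both sides append
raised-step-one-end : ∀ k rest →
  Raised (insertLetter ((ones k ++ unp 1 ∷ []) ∷ rest) 1) (insertLetter (updateAt (ones k ++ unp 1 ∷ []) k (raise k) ∷ rest) 1) (suc k)
raised-step-one-end k rest with fuel-large ((ones k ++ unp 1 ∷ []) ∷ rest)
... | g , fe , _ =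
  ([] , trans (cong (λ Z → getRow Z 0) ins₁) (trans (++-assoc (ones k) _ _) (replicate-snoc k (unp 1) (unp 1 ∷ []))) , [])
  , trans (raised-insert-one g k [] rest (trans (fuel-setEntry-zero row rest k (raise k)) fe))
      (trans (cong proj₁ (ins-col-append g (suc k) (pri 2) T 0 (2'-appends-after-ones k rest)))
        (trans (cong (_∷ rest) ends-with-2')
               (cong (λ Z → setEntry Z 0 (suc k) (pri 2)) (sym ins₁))))
  where
  row : List Letter
  row = ones k ++ unp 1 ∷ []
  T : Tab Letter
  T = row ∷ rest
  ins₁ : insertLetter T 1 ≡ (row ++ unp 1 ∷ []) ∷ rest
  ins₁ = trans (insertLetter-fuel T 1 _ fe)
           (cong proj₁ (ins-row-append (suc g) 0 (unp 1) T (rowBump-over-ones (unp 1) k (unp 1 ∷ []) ≤-refl)))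
  ends-with-2' : row ++ pri 2 ∷ [] ≡ updateAt (row ++ unp 1 ∷ []) (suc k) (pri 2)
  ends-with-2' = begin
    row ++ pri 2 ∷ []                                       ≡⟨ ++-assoc (ones k) _ _ ⟩
    ones k ++ unp 1 ∷ pri 2 ∷ []                            ≡⟨ updateAt-replicate-next k (unp 1) (unp 1) (unp 1) (pri 2) [] ⟨
    updateAt (ones k ++ unp 1 ∷ unp 1 ∷ []) (suc k) (pri 2) ≡⟨ cong (λ z → updateAt z (suc k) (pri 2)) (++-assoc (ones k) _ _) ⟨
    updateAt (row ++ unp 1 ∷ []) (suc k) (pri 2)            ∎
    where open ≡-Reasoning

-- inserting 1 when a large entry a follows the run: on the left 1 bumps a; on
-- the right the 2' bumps a, after which both sides continue identically
raised-step-one-bump : ∀ k a R rest → 5 ≤ code a → AtLeast 5 R →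
  Raised (insertLetter ((ones k ++ unp 1 ∷ a ∷ R) ∷ rest) 1)
         (insertLetter (updateAt (ones k ++ unp 1 ∷ a ∷ R) k (raise k) ∷ rest) 1) (suc k)
raised-step-one-bump k a R rest a≥5 R≥5 with fuel-large ((ones k ++ unp 1 ∷ a ∷ R) ∷ rest)
... | g , fe , size<g =
  FirstRow⇒OnesRow-suc k (insertLetter T 1) (FirstRow-transport ins₁
    (insert-keeps-prefix (++⁺ (ones-small 5 k 3≤5) (3≤5 ∷ 3≤5 ∷ [])) (suc g) m a' T₁
       (R , trans (updateAt-replicate-next k (unp 1) (unp 1) a (unp 1) R) (sym (++-assoc (ones k) _ R)) , R≥5) a'≥5))
  , (begin
      insertLetter (updateAt row k (raise k) ∷ rest) 1
        ≡⟨ raised-insert-one g k (a ∷ R) rest (trans (fuel-setEntry-zero row rest k (raise k)) fe) ⟩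
      proj₁ (ins (suc g) (colM (suc k)) (pri 2) T)
        ≡⟨ cong proj₁ (ins-col-bump g (suc k) (pri 2) T 0 a (2'-bumps-after-ones k a R rest a≥5)) ⟩
      proj₁ (ins g m a' X)
        ≡⟨ ins-fuel-irrelevant g (suc g) m a' X enough (m<n⇒m<1+n enough) ⟩
      proj₁ (ins (suc g) m a' X)
        ≡⟨ cong (λ z → proj₁ (ins (suc g) m a' (z ∷ rest))) (updateAt-idem row (suc k) (unp 1) (pri 2)) ⟨
      proj₁ (ins (suc g) m a' (setEntry T₁ 0 (suc k) (pri 2)))
        ≡⟨ insert-setEntry-comm (suc k) (pri 2) 4≤5 (suc g) m a' T₁ a'≥5
             (at-updateAt-same row (suc k) (unp 1) (at-replicate-next k (unp 1) (unp 1) (a ∷ R))) ⟩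
      setEntry (proj₁ (ins (suc g) m a' T₁)) 0 (suc k) (pri 2)
        ≡⟨ cong (λ Z → setEntry Z 0 (suc k) (pri 2)) ins₁ ⟨
      setEntry (insertLetter T 1) 0 (suc k) (pri 2) ∎)
  where
  open ≡-Reasoning
  row : List Letter
  row = ones k ++ unp 1 ∷ a ∷ R
  T : Tab Letter
  T = row ∷ rest
  m : Mode
  m = proj₁ (afterBump 0 (suc k) a)
  a' : Letter
  a' = proj₂ (afterBump 0 (suc k) a)
  T₁ : Tab Letter
  T₁ = updateAt row (suc k) (unp 1) ∷ rest
  X : Tab Letter
  X = updateAt row (suc k) (pri 2) ∷ rest
  a'≥5 : 5 ≤ code a'
  a'≥5 = subst (λ z → 5 ≤ code z) (sym (afterBump-offdiag k a)) a≥5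
  ins₁ : insertLetter T 1 ≡ proj₁ (ins (suc g) m a' T₁)
  ins₁ = trans (insertLetter-fuel T 1 _ fe) (cong proj₁ (ins-row-bump (suc g) 0 (unp 1) T (suc k) a (1-bumps-after-ones k a R (≤-trans 4≤5 a≥5))))
  enough : countAbove (code a') X < g
  enough = ≤-<-trans (countAbove-size (code a') X) (subst (_< g) (sym (size-setEntry-zero row rest (suc k) (pri 2))) size<g)

raised-step : ∀ T T' k b → 1 ≤ b → Raised T T' k → ∃[ k' ] Raised (insertLetter T b) (insertLetter T' b) k'
raised-step [] T' k b h ((R , e , _) , _) = ⊥-elim (no-row k e)
  where
  no-row : ∀ k → [] ≢ ones k ++ unp 1 ∷ R
  no-row zero    ()
  no-row (suc k) ()
raised-step (row ∷ rest) T' k (suc zero) h ((R , refl , R≥5) , refl) with R | R≥5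
... | []     | []            = suc k , raised-step-one-end k rest
... | a ∷ R' | a≥5 ∷ R'≥5    = suc k , raised-step-one-bump k a R' rest a≥5 R'≥5
-- letters ≥ 2 never touch the run of 1's nor the raised letter
raised-step (row ∷ rest) T' k (suc (suc b)) h ((R , refl , R≥5) , refl) =
  k , FirstRow⇒OnesRow k (insertLetter T (suc (suc b)))
        (insert-keeps-prefix (++⁺ (ones-small 5 k 3≤5) (3≤5 ∷ [])) (fuel T) (rowM 0) _ T
           (R , sym (++-assoc (ones k) _ R) , R≥5) b≥2)
    , trans (cong (λ f → proj₁ (ins f (rowM 0) (unp (suc (suc b))) (setEntry T 0 k (raise k))))
                  (fuel-setEntry-zero row rest k (raise k)))
            (insert-setEntry-comm k (raise k) (raise-small k) (fuel T) (rowM 0) _ T b≥2 (at-replicate k (unp 1) (unp 1) R))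
  where
  T : Tab Letter
  T = row ∷ rest
  b≥2 : 5 ≤ code (unp (suc (suc b)))
  b≥2 = code-≥2 (suc (suc b)) (s≤s (s≤s z≤n))

raised-word : ∀ T T' k w → All (1 ≤_) w → Raised T T' k → ∃[ k' ] Raised (insertWord T w) (insertWord T' w) k'
raised-word T T' k []      _        r = k , r
raised-word T T' k (b ∷ w) (h ∷ hs) r with raised-step T T' k b h r
... | k' , r' = raised-word (insertLetter T b) (insertLetter T' b) k' w hs r'

data Cut : List ℕ → Set where
  no-small  : ∀ {b} → All (3 ≤_) b → Cut b
  two-first : ∀ u w → All (3 ≤_) u → All (1 ≤_) w → Cut (u ++ 2 ∷ w)
  one-first : ∀ u v → All (3 ≤_) u → All (1 ≤_) v → Cut (u ++ 1 ∷ v)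

cut : ∀ b → All (1 ≤_) b → Cut b
cut []                          []       = no-small []
cut (zero ∷ bs)                 (() ∷ _)
cut (suc zero ∷ bs)             (_ ∷ h)  = one-first [] bs [] h
cut (suc (suc zero) ∷ bs)       (_ ∷ h)  = two-first [] bs [] h
cut (c@(suc (suc (suc _))) ∷ bs) (_ ∷ h) with cut bs h
... | no-small l          = no-small (s≤s (s≤s (s≤s z≤n)) ∷ l)
... | two-first u w lu pw = two-first (c ∷ u) w (s≤s (s≤s (s≤s z≤n)) ∷ lu) pw
... | one-first u v lu pv = one-first (c ∷ u) v (s≤s (s≤s (s≤s z≤n)) ∷ lu) pv

fbar1-no-small : ∀ b → All (3 ≤_) b → fbar1 b ≡ nothing
fbar1-no-small []                          _              = refl
fbar1-no-small (suc zero ∷ bs)             (s≤s () ∷ _)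
fbar1-no-small (suc (suc zero) ∷ bs)       (s≤s (s≤s ()) ∷ _)
fbar1-no-small (c@(suc (suc (suc _))) ∷ bs) (_ ∷ h)       = cong (Maybe.map (c ∷_)) (fbar1-no-small bs h)

fbar1-two-first : ∀ u w → All (3 ≤_) u → fbar1 (u ++ 2 ∷ w) ≡ nothing
fbar1-two-first []                          w _              = refl
fbar1-two-first (suc zero ∷ u)              w (s≤s () ∷ _)
fbar1-two-first (suc (suc zero) ∷ u)        w (s≤s (s≤s ()) ∷ _)
fbar1-two-first (c@(suc (suc (suc _))) ∷ u) w (_ ∷ h)       = cong (Maybe.map (c ∷_)) (fbar1-two-first u w h)

fbar1-one-first : ∀ u v → All (3 ≤_) u → fbar1 (u ++ 1 ∷ v) ≡ just (u ++ 2 ∷ v)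
fbar1-one-first []                          v _              = refl
fbar1-one-first (suc zero ∷ u)              v (s≤s () ∷ _)
fbar1-one-first (suc (suc zero) ∷ u)        v (s≤s (s≤s ()) ∷ _)
fbar1-one-first (c@(suc (suc (suc _))) ∷ u) v (_ ∷ h)       = cong (Maybe.map (c ∷_)) (fbar1-one-first u v h)

large-first-row : ∀ u → All (3 ≤_) u → FirstRow [] 6 (insertWord [] u)
large-first-row u large = insertWord-keeps-prefix [] [] u ([] , refl , []) (All.map (λ {b} → code-≥3 b) large)

RightmostCases : List ℕ → Tab Letter → ℕ → Set
RightmostCases b T k =
  (k ≡ 0 →
    (at (getRow T 0) 1 ≡ just (pri 2) → fbar1P-word b ≡ nothing) ×
    (at (getRow T 0) 1 ≢ just (pri 2) → fbar1P-word b ≡ just (setEntry T 0 0 (unp 2)))) ×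
  (1 ≤ k →
    (at (getRow T 0) (suc k) ≡ just (pri 2) → fbar1P-word b ≡ nothing) ×
    (at (getRow T 0) (suc k) ≢ just (pri 2) → fbar1P-word b ≡ just (setEntry T 0 k (pri 2))))

Conclusion : List ℕ → Tab Letter → Set
Conclusion b T =
  ((∀ j → at (getRow T 0) j ≢ just (unp 1)) → fbar1P-word b ≡ nothing) ×
  (∀ k → RightmostOne (getRow T 0) k → RightmostCases b T k)

NoOne : List Letter → Set
NoOne X = ∀ i → at X i ≢ just (unp 1)

++-no-one : ∀ P R → NoOne P → NoOne R → NoOne (P ++ R)
++-no-one []      R _  nr         = nr
++-no-one (p ∷ P) R np nr zero    = np zero
++-no-one (p ∷ P) R np nr (suc i) = ++-no-one P R (np ∘ suc) nr i

at-AtLeast : ∀ {t} R k {a} → AtLeast t R → at R k ≡ just a → t ≤ code a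
at-AtLeast (x ∷ R) zero    (g ∷ _)  refl = g
at-AtLeast (x ∷ R) (suc k) (_ ∷ gs) e    = at-AtLeast R k gs e

large-no-one : ∀ {t} R → 4 ≤ t → AtLeast t R → NoOne R
large-no-one R 4≤t g i e = <-irrefl refl (≤-trans 4≤t (at-AtLeast R i g e))

FirstRow-no-one : ∀ {P t} T → 4 ≤ t → FirstRow P t T → NoOne P → NoOne (getRow T 0)
FirstRow-no-one {P} T 4≤t (R , e , g) np i = subst (λ row → at row i ≢ just (unp 1)) (sym e)
  (++-no-one P R np (large-no-one R 4≤t g) i)

rightmost-one : ∀ {row} j X → row ≡ ones j ++ unp 1 ∷ X → NoOne X → ∀ k → RightmostOne row k → k ≡ j
rightmost-one j X refl nx k (is-one , none-after) with <-cmp k j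
... | tri< k<j _ _ = ⊥-elim (none-after j k<j (at-replicate j (unp 1) (unp 1) X))
... | tri≈ _ k≡j _ = k≡j
... | tri> _ _ j<k = ⊥-elim (nx (k ∸ suc j)
  (trans (sym (at-replicate-beyond j (unp 1) (unp 1) X (k ∸ suc j)))
         (trans (cong (at (ones j ++ unp 1 ∷ X)) (m+[n∸m]≡n j<k)) is-one)))

conclusion-no-one : ∀ b T → fbar1 b ≡ nothing → NoOne (getRow T 0) → Conclusion b T
conclusion-no-one b T fb none = (λ _ → cong (Maybe.map PHM) fb) , λ k r → ⊥-elim (none k (proj₁ r))

conclusion-blocked : ∀ b T j R → fbar1 b ≡ nothing → getRow T 0 ≡ ones j ++ unp 1 ∷ pri 2 ∷ R → AtLeast 5 R →
  Conclusion b T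
conclusion-blocked b T j R fb row R≥5 = (λ _ → zero-result) , at-rightmost
  where
  zero-result : fbar1P-word b ≡ nothing
  zero-result = cong (Maybe.map PHM) fb
  followed-by-2' : at (getRow T 0) (suc j) ≡ just (pri 2)
  followed-by-2' = trans (cong (λ z → at z (suc j)) row) (at-replicate-next j (unp 1) (unp 1) (pri 2 ∷ R))
  at-rightmost : ∀ k → RightmostOne (getRow T 0) k → RightmostCases b T k
  at-rightmost k r with rightmost-one j (pri 2 ∷ R) row (++-no-one (pri 2 ∷ []) R (λ { zero () ; (suc _) () })
                          (large-no-one R 4≤5 R≥5)) k r
  ... | refl = (λ k≡0 → (λ _ → zero-result) ,
                        (λ ne → ⊥-elim (ne (subst (λ z → at (getRow T 0) (suc z) ≡ just (pri 2)) k≡0 followed-by-2'))))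
             , (λ _ → (λ _ → zero-result) , (λ ne → ⊥-elim (ne followed-by-2')))

conclusion-raised : ∀ b b' T j R → fbar1 b ≡ just b' → getRow T 0 ≡ ones j ++ unp 1 ∷ R → AtLeast 5 R →
  PHM b' ≡ setEntry T 0 j (raise j) → Conclusion b T
conclusion-raised b b' T j R fb row R≥5 ph = has-one , at-rightmost
  where
  result : fbar1P-word b ≡ just (setEntry T 0 j (raise j))
  result = trans (cong (Maybe.map PHM) fb) (cong just ph)
  has-one : (∀ i → at (getRow T 0) i ≢ just (unp 1)) → fbar1P-word b ≡ nothing
  has-one none = ⊥-elim (none j (trans (cong (λ z → at z j) row) (at-replicate j (unp 1) (unp 1) R)))
  not-followed-by-2' : at (getRow T 0) (suc j) ≢ just (pri 2)
  not-followed-by-2' a2 = <-irrefl refl (at-AtLeast R 0 R≥5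
    (trans (sym (at-replicate-next j (unp 1) (unp 1) R)) (trans (cong (λ z → at z (suc j)) (sym row)) a2)))
  at-rightmost : ∀ k → RightmostOne (getRow T 0) k → RightmostCases b T k
  at-rightmost k r with rightmost-one j R row (large-no-one R 4≤5 R≥5) k r
  ... | refl =
    (λ k≡0 → (λ a2 → ⊥-elim (not-followed-by-2' (subst (λ z → at (getRow T 0) (suc z) ≡ just (pri 2)) (sym k≡0) a2)))
           , (λ _ → trans result (cong (λ z → just (setEntry T 0 z (raise z))) k≡0)))
    , λ { k≥1 → (⊥-elim ∘ not-followed-by-2') , (λ _ → trans result (cong (λ x → just (setEntry T 0 k x)) (raise-pos k k≥1))) }
    where
    raise-pos : ∀ k → 1 ≤ k → raise k ≡ pri 2
    raise-pos (suc k) _ = refl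

conclusion-two-first : ∀ u w → All (3 ≤_) u → All (1 ≤_) w → Conclusion (u ++ 2 ∷ w) (insertWord [] (u ++ 2 ∷ w))
conclusion-two-first u w large pos-w =
  subst (Conclusion (u ++ 2 ∷ w)) (sym (insertWord-++ [] u (2 ∷ w)))
    (from-state (twoFirst-word (insertLetter T₀ 2) w pos-w (inj₁ (twoFirst-init T₀ (large-first-row u large)))))
  where
  T₀ : Tab Letter
  T₀ = insertWord [] u
  from-state : ∀ {Z} → TwoFirst Z → Conclusion (u ++ 2 ∷ w) Z
  from-state {Z} (inj₁ fr) =
    conclusion-no-one (u ++ 2 ∷ w) Z (fbar1-two-first u w large) (FirstRow-no-one Z 4≤5 fr (λ { zero () ; (suc _) () }))
  from-state {Z} (inj₂ (j , R , row , R≥5)) =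
    conclusion-blocked (u ++ 2 ∷ w) Z j R (fbar1-two-first u w large) (trans row (++-assoc (ones j) _ R)) R≥5

conclusion-one-first : ∀ u v → All (3 ≤_) u → All (1 ≤_) v → Conclusion (u ++ 1 ∷ v) (insertWord [] (u ++ 1 ∷ v))
conclusion-one-first u v large pos-v
  with raised-word (insertLetter T₀ 1) (insertLetter T₀ 2) 0 v pos-v (raised-init T₀ (large-first-row u large))
  where
  T₀ : Tab Letter
  T₀ = insertWord [] u
... | k , (R , row , R≥5) , raised =
  subst (Conclusion (u ++ 1 ∷ v)) (sym (insertWord-++ [] u (1 ∷ v)))
    (conclusion-raised (u ++ 1 ∷ v) (u ++ 2 ∷ v) _ k R (fbar1-one-first u v large) row R≥5
       (trans (PHM-insertWord (u ++ 2 ∷ v)) (trans (insertWord-++ [] u (2 ∷ v)) raised)))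

conclusion : ∀ b → All (1 ≤_) b → Conclusion b (insertWord [] b)
conclusion b pos with cut b pos
... | no-small large =
  conclusion-no-one b _ (fbar1-no-small b large)
    (FirstRow-no-one (insertWord [] b) (m≤n⇒m≤1+n 4≤5) (large-first-row b large) (λ _ ()))
... | two-first u w large pos-w = conclusion-two-first u w large pos-w
... | one-first u v large pos-v = conclusion-one-first u v large pos-v

-- Only P_HM(b) = T and the positivity of the letters of b are needed; the
-- conclusion is Conclusion b T, established for P(b) above.
lemma3p8 : (n : ℕ) → 2 ≤ n → (sh : List ℕ) → StrictPartition sh →
    (T : Tab Letter) → PrimedTableau n sh T →
    (Q : Tab ℕ) → StandardShifted sh Q →
    (b : List ℕ) → Word n b → HM b ≡ (T , Q) →
    ((∀ j → at (getRow T 0) j ≢ just (unp 1)) → fbar1P-word b ≡ nothing) ×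
    (∀ k → RightmostOne (getRow T 0) k →
      (k ≡ 0 →
        (at (getRow T 0) 1 ≡ just (pri 2) → fbar1P-word b ≡ nothing) ×
        (at (getRow T 0) 1 ≢ just (pri 2) → fbar1P-word b ≡ just (setEntry T 0 0 (unp 2)))) ×
      (1 ≤ k →
        (at (getRow T 0) (suc k) ≡ just (pri 2) → fbar1P-word b ≡ nothing) ×
        (at (getRow T 0) (suc k) ≢ just (pri 2) → fbar1P-word b ≡ just (setEntry T 0 k (pri 2)))))
lemma3p8 n _ sh _ T _ Q _ b word hm =
  subst (Conclusion b) (trans (sym (PHM-insertWord b)) (cong proj₁ hm)) (conclusion b (All.map proj₁ word))
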